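{- For any nonnegative integer $k$, \[ \sum_{i=0}^k \frac{1}{2i+1}\binom{k+i}{2i}=\frac{L_{2k+1}}{2k+1},\qquad \sum_{i=0}^k \frac{(-5)^i}{2i+1}\binom{k+i}{2i}=(-1)^k\frac{F_{2k+1}}{2k+1},\qquad \sum_{i=0}^k (-5)^i\binom{k+i}{2i}=(-1)^k L_{2k+1}. \]
   Context: $F_n$ and $L_n$ are the Fibonacci and Lucas numbers: $F_0=0$, $F_1=1$, $L_0=2$, $L_1=1$, and both satisfy $a_n=a_{n-1}+a_{n-2}$. -}

module Defs where

open import Data.Nat using (ℕ; zero; suc; _+_)
import Data.Integer as ℤ
import Data.Rational as ℚ

F : ℕ → ℕ
F zero = 0
F (suc zero) = 1
F (suc (suc n)) = F (suc n) + F n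

L : ℕ → ℕ
L zero = 2
L (suc zero) = 1
L (suc (suc n)) = L (suc n) + L n

sumℚ : ℕ → (ℕ → ℚ.ℚ) → ℚ.ℚ
sumℚ zero f = f 0
sumℚ (suc k) f = sumℚ k f ℚ.+ f (suc k)

sumℤ : ℕ → (ℕ → ℤ.ℤ) → ℤ.ℤ
sumℤ zero f = f 0
sumℤ (suc k) f = sumℤ k f ℤ.+ f (suc k)

-- Write b_k(x) = ∑ᵢ xⁱ C(k+i, 2i) and c_k(x) = ∑ᵢ xⁱ C(k+i, 2i+1). Pascal's rule gives
-- c_{k+1} = b_k + c_k and b_{k+1} = b_k + x c_{k+1}, a recurrence determining both
-- sequences: at x = 1 they are F_{2k+1} and F_{2k}, at x = −5 they are (−1)ᵏ L_{2k+1}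
-- and −(−1)ᵏ F_{2k}. Absorption and Pascal's rule give
-- (2k+1) C(k+i, 2i) = (2i+1) (C(k+i+1, 2i+1) + C(k+i, 2i+1)), so that
-- ∑ᵢ xⁱ C(k+i, 2i) / (2i+1) = (c_{k+1}(x) + c_k(x)) / (2k+1); then
-- F_{2k+2} + F_{2k} = L_{2k+1} and F_{2k+2} − F_{2k} = F_{2k+1}.
module Submission where

open import Defs
open import Data.Nat using (ℕ; suc; _+_; _*_)
open import Data.Nat.Combinatorics using (_C_)
open import Data.Integer using (ℤ; +_; -[1+_]) renaming (_*_ to _*ℤ_; _^_ to _^ℤ_)
open import Data.Rational using (ℚ; _/_) renaming (_*_ to _*ℚ_)
open import Data.Product using (_×_)
open import Relation.Binary.PropositionalEquality using (_≡_)

open import Data.Nat using (zero; _<_; s≤s; z≤n)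
open import Data.Nat.Properties
  using (+-suc; +-comm; +-identityʳ; +-cancelʳ-≡; *-distribˡ-+; *-zeroʳ; *-identityˡ; *-identityʳ; ≤-reflexive)
open import Data.Nat.Combinatorics using (nCk+nC[k+1]≡[n+1]C[k+1]; k>n⇒nCk≡0; nC1≡n)
open import Data.Integer using (0ℤ; 1ℤ; -1ℤ; -_) renaming (_+_ to _+ℤ_; _-_ to _-ℤ_)
import Data.Integer.Properties as ℤ
open import Data.Rational using (fromℚᵘ; toℚᵘ) renaming (_+_ to _+ℚ_)
open import Data.Rational.Properties using (toℚᵘ-injective; toℚᵘ-homo-+; toℚᵘ-fromℚᵘ; fromℚᵘ-cong)
open import Data.Rational.Unnormalised as ℚᵘ using (mkℚᵘ; *≡*)
import Data.Rational.Unnormalised.Properties as ℚᵘ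
open import Data.Product using (_,_; proj₁; proj₂)
open import Function using (_∘_)
open import Relation.Binary.PropositionalEquality using (refl; sym; trans; cong; cong₂; module ≡-Reasoning)
import Data.Nat.Tactic.RingSolver as ℕ-Solver
import Data.Integer.Tactic.RingSolver as ℤ-Solver

sumℤ-cong : ∀ k {f g : ℕ → ℤ} → (∀ i → f i ≡ g i) → sumℤ k f ≡ sumℤ k g
sumℤ-cong zero    f≗g = f≗g 0
sumℤ-cong (suc k) f≗g = cong₂ _+ℤ_ (sumℤ-cong k f≗g) (f≗g (suc k))

sumℚ-cong : ∀ k {f g : ℕ → ℚ} → (∀ i → f i ≡ g i) → sumℚ k f ≡ sumℚ k g
sumℚ-cong zero    f≗g = f≗g 0
sumℚ-cong (suc k) f≗g = cong₂ _+ℚ_ (sumℚ-cong k f≗g) (f≗g (suc k))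

sumℤ-+ : ∀ k (f g : ℕ → ℤ) → sumℤ k (λ i → f i +ℤ g i) ≡ sumℤ k f +ℤ sumℤ k g
sumℤ-+ zero    f g = refl
sumℤ-+ (suc k) f g = trans (cong (_+ℤ (f (suc k) +ℤ g (suc k))) (sumℤ-+ k f g))
                           (interchange (sumℤ k f) (sumℤ k g) (f (suc k)) (g (suc k)))
  where
  interchange : ∀ a b c d → (a +ℤ b) +ℤ (c +ℤ d) ≡ (a +ℤ c) +ℤ (b +ℤ d)
  interchange = ℤ-Solver.solve-∀

sumℤ-*ˡ : ∀ k x (f : ℕ → ℤ) → sumℤ k (λ i → x *ℤ f i) ≡ x *ℤ sumℤ k f
sumℤ-*ˡ zero    x f = refl
sumℤ-*ˡ (suc k) x f = trans (cong (_+ℤ x *ℤ f (suc k)) (sumℤ-*ˡ k x f)) (sym (ℤ.*-distribˡ-+ x _ _))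

sumℤ-suc : ∀ k (f : ℕ → ℤ) → sumℤ (suc k) f ≡ f 0 +ℤ sumℤ k (f ∘ suc)
sumℤ-suc zero    f = refl
sumℤ-suc (suc k) f = trans (cong (_+ℤ f (suc (suc k))) (sumℤ-suc k f)) (ℤ.+-assoc (f 0) _ _)

sumℤ-dropLast : ∀ k (f : ℕ → ℤ) → f (suc k) ≡ 0ℤ → sumℤ (suc k) f ≡ sumℤ k f
sumℤ-dropLast k f fk+1≡0 = trans (cong (sumℤ k f +ℤ_) fk+1≡0) (ℤ.+-identityʳ (sumℤ k f))

fromℚᵘ-homo-+ : ∀ p q → fromℚᵘ (p ℚᵘ.+ q) ≡ fromℚᵘ p +ℚ fromℚᵘ q
fromℚᵘ-homo-+ p q = toℚᵘ-injective (begin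
  toℚᵘ (fromℚᵘ (p ℚᵘ.+ q))                ≈⟨ toℚᵘ-fromℚᵘ (p ℚᵘ.+ q) ⟩
  p ℚᵘ.+ q                                ≈⟨ ℚᵘ.+-cong (toℚᵘ-fromℚᵘ p) (toℚᵘ-fromℚᵘ q) ⟨
  toℚᵘ (fromℚᵘ p) ℚᵘ.+ toℚᵘ (fromℚᵘ q)    ≈⟨ toℚᵘ-homo-+ (fromℚᵘ p) (fromℚᵘ q) ⟨
  toℚᵘ (fromℚᵘ p +ℚ fromℚᵘ q)             ∎)
  where open ℚᵘ.≃-Reasoning

+-distrib-/ : ∀ a b d → (a +ℤ b) / suc d ≡ a / suc d +ℚ b / suc d
+-distrib-/ a b d =
  trans (fromℚᵘ-cong {mkℚᵘ (a +ℤ b) d} {mkℚᵘ a d ℚᵘ.+ mkℚᵘ b d} (*≡* same-denominator))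
        (fromℚᵘ-homo-+ (mkℚᵘ a d) (mkℚᵘ b d))
  where
  D = + suc d
  same-denominator : (a +ℤ b) *ℤ (D *ℤ D) ≡ (a *ℤ D +ℤ b *ℤ D) *ℤ D
  same-denominator = trans (cong ((a +ℤ b) *ℤ_) (sym (ℤ.pos-* (suc d) (suc d)))) (lemma a b D)
    where
    lemma : ∀ a b D → (a +ℤ b) *ℤ (D *ℤ D) ≡ (a *ℤ D +ℤ b *ℤ D) *ℤ D
    lemma = ℤ-Solver.solve-∀

sumℚ-/ : ∀ k d (f : ℕ → ℤ) → sumℚ k (λ i → f i / suc d) ≡ sumℤ k f / suc d
sumℚ-/ zero    d f = refl
sumℚ-/ (suc k) d f = trans (cong (_+ℚ f (suc k) / suc d) (sumℚ-/ k d f))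
                           (sym (+-distrib-/ (sumℤ k f) (f (suc k)) d))

*≡*⇒/≡ : ∀ a b d e → a *ℤ + suc e ≡ b *ℤ + suc d → a / suc d ≡ b / suc e
*≡*⇒/≡ a b d e eq = fromℚᵘ-cong {mkℚᵘ a d} {mkℚᵘ b e} (*≡* eq)

pascal : ∀ n k → suc n C suc k ≡ n C k + n C suc k
pascal n k = sym (nCk+nC[k+1]≡[n+1]C[k+1] n k)

absorption : ∀ n k → suc k * (suc n C suc k) ≡ suc n * (n C k)
absorption zero    zero    = refl
absorption zero    (suc k) =
  trans (cong (suc (suc k) *_) (k>n⇒nCk≡0 (s≤s (s≤s (z≤n {k}))))) (*-zeroʳ (suc (suc k)))
absorption (suc n) zero    =
  trans (*-identityˡ _) (trans (nC1≡n (suc (suc n))) (sym (*-identityʳ _)))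
absorption (suc n) (suc k) = begin
  (2 + k) * (suc (suc n) C suc (suc k))
    ≡⟨ cong ((2 + k) *_) (pascal (suc n) (suc k)) ⟩
  (2 + k) * (p + c)
    ≡⟨ expand k p c ⟩
  p + (1 + k) * p + (2 + k) * c
    ≡⟨ cong₂ (λ u v → p + u + v) (absorption n k) (absorption n (suc k)) ⟩
  p + (1 + n) * a + (1 + n) * b
    ≡⟨ collect n p a b ⟩
  p + (1 + n) * (a + b)
    ≡⟨ cong (λ t → p + (1 + n) * t) (pascal n k) ⟨
  p + (1 + n) * p
    ∎
  where
  open ≡-Reasoning
  a = n C k
  b = n C suc k
  p = suc n C suc k
  c = suc n C suc (suc k)
  expand : ∀ k p c → (2 + k) * (p + c) ≡ p + (1 + k) * p + (2 + k) * c
  expand = ℕ-Solver.solve-∀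
  collect : ∀ n p a b → p + (1 + n) * a + (1 + n) * b ≡ p + (1 + n) * (a + b)
  collect = ℕ-Solver.solve-∀

-- After adding (2i+1) X to both sides, with X = C(k+i, 2i), both become
-- 2 (2i+1) C(k+i+1, 2i+1) by absorption and Pascal's rule.
odd-weight-shift : ∀ k i →
  ((k + i) C (2 * i)) * suc (2 * k) ≡ (suc (k + i) C suc (2 * i) + (k + i) C suc (2 * i)) * suc (2 * i)
odd-weight-shift k i = +-cancelʳ-≡ (X * suc (2 * i)) _ _ (begin
  X * suc (2 * k) + X * suc (2 * i)
    ≡⟨ collect k i X ⟩
  2 * (suc (k + i) * X)
    ≡⟨ cong (2 *_) (absorption (k + i) (2 * i)) ⟨
  2 * (suc (2 * i) * Z)
    ≡⟨ cong (λ t → 2 * (suc (2 * i) * t)) (pascal (k + i) (2 * i)) ⟩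
  2 * (suc (2 * i) * (X + Y))
    ≡⟨ split i X Y ⟩
  ((X + Y) + Y) * suc (2 * i) + X * suc (2 * i)
    ≡⟨ cong (λ t → (t + Y) * suc (2 * i) + X * suc (2 * i)) (pascal (k + i) (2 * i)) ⟨
  (Z + Y) * suc (2 * i) + X * suc (2 * i)
    ∎)
  where
  open ≡-Reasoning
  X = (k + i) C (2 * i)
  Y = (k + i) C suc (2 * i)
  Z = suc (k + i) C suc (2 * i)
  collect : ∀ k i X → X * suc (2 * k) + X * suc (2 * i) ≡ 2 * (suc (k + i) * X)
  collect = ℕ-Solver.solve-∀
  split : ∀ i X Y → 2 * (suc (2 * i) * (X + Y)) ≡ ((X + Y) + Y) * suc (2 * i) + X * suc (2 * i)
  split = ℕ-Solver.solve-∀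

mvb-term mvc-term : ℤ → ℕ → ℕ → ℤ
mvb-term x k i = (x ^ℤ i) *ℤ (+ ((k + i) C (2 * i)))
mvc-term x k i = (x ^ℤ i) *ℤ (+ ((k + i) C suc (2 * i)))

mvb mvc : ℤ → ℕ → ℤ
mvb x k = sumℤ k (mvb-term x k)
mvc x k = sumℤ k (mvc-term x k)

two-suc : ∀ i → 2 * suc i ≡ suc (suc (2 * i))
two-suc i = cong suc (+-suc i (i + 0))

*-C-vanishes : ∀ y {n m} → n < m → y *ℤ (+ (n C m)) ≡ 0ℤ
*-C-vanishes y n<m = trans (cong (λ t → y *ℤ (+ t)) (k>n⇒nCk≡0 n<m)) (ℤ.*-zeroʳ y)

*-pascal : ∀ y n m → y *ℤ (+ (suc n C suc m)) ≡ y *ℤ (+ (n C m)) +ℤ y *ℤ (+ (n C suc m))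
*-pascal y n m = trans (cong (λ t → y *ℤ (+ t)) (pascal n m))
                       (trans (cong (y *ℤ_) (ℤ.pos-+ (n C m) (n C suc m))) (ℤ.*-distribˡ-+ y _ _))

mvb-dropLast : ∀ x k → sumℤ (suc k) (mvb-term x k) ≡ mvb x k
mvb-dropLast x k = sumℤ-dropLast k (mvb-term x k)
  (*-C-vanishes (x ^ℤ suc k) (s≤s (≤-reflexive (cong (λ t → k + t) (sym (+-identityʳ (suc k)))))))

mvc-dropLast : ∀ x k → mvc x (suc k) ≡ sumℤ k (mvc-term x (suc k))
mvc-dropLast x k = sumℤ-dropLast k (mvc-term x (suc k))
  (*-C-vanishes (x ^ℤ suc k) (s≤s (s≤s (≤-reflexive (cong (λ t → k + t) (sym (+-identityʳ (suc k))))))))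

mvc-suc : ∀ x k → mvc x (suc k) ≡ mvb x k +ℤ mvc x k
mvc-suc x k = begin
  mvc x (suc k)                                        ≡⟨ mvc-dropLast x k ⟩
  sumℤ k (mvc-term x (suc k))                          ≡⟨ sumℤ-cong k (λ i → *-pascal (x ^ℤ i) (k + i) (2 * i)) ⟩
  sumℤ k (λ i → mvb-term x k i +ℤ mvc-term x k i)      ≡⟨ sumℤ-+ k (mvb-term x k) (mvc-term x k) ⟩
  mvb x k +ℤ mvc x k                                   ∎
  where open ≡-Reasoning

mvb-term-suc : ∀ x k i → mvb-term x (suc k) (suc i) ≡ x *ℤ mvc-term x (suc k) i +ℤ mvb-term x k (suc i)
mvb-term-suc x k i = begin
  y *ℤ (+ (suc n C (2 * suc i)))
    ≡⟨ cong (λ j → y *ℤ (+ (suc n C j))) (two-suc i) ⟩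
  y *ℤ (+ (suc n C suc (suc (2 * i))))
    ≡⟨ *-pascal y n (suc (2 * i)) ⟩
  y *ℤ (+ (n C suc (2 * i))) +ℤ y *ℤ (+ (n C suc (suc (2 * i))))
    ≡⟨ cong₂ _+ℤ_ first-term (cong (λ j → y *ℤ (+ (n C j))) (two-suc i)) ⟨
  x *ℤ mvc-term x (suc k) i +ℤ mvb-term x k (suc i)
    ∎
  where
  open ≡-Reasoning
  y = x ^ℤ suc i
  n = k + suc i
  first-term : x *ℤ mvc-term x (suc k) i ≡ y *ℤ (+ (n C suc (2 * i)))
  first-term = trans (sym (ℤ.*-assoc x (x ^ℤ i) _)) (cong (λ t → y *ℤ (+ (t C suc (2 * i)))) (sym (+-suc k i)))

mvb-suc : ∀ x k → mvb x (suc k) ≡ mvb x k +ℤ x *ℤ mvc x (suc k)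
mvb-suc x k = begin
  mvb x (suc k)
    ≡⟨ sumℤ-suc k (mvb-term x (suc k)) ⟩
  t₀ +ℤ sumℤ k (mvb-term x (suc k) ∘ suc)
    ≡⟨ cong (t₀ +ℤ_) (sumℤ-cong k (mvb-term-suc x k)) ⟩
  t₀ +ℤ sumℤ k (λ i → x *ℤ mvc-term x (suc k) i +ℤ b′ i)
    ≡⟨ cong (t₀ +ℤ_) (sumℤ-+ k _ b′) ⟩
  t₀ +ℤ (sumℤ k (λ i → x *ℤ mvc-term x (suc k) i) +ℤ sumℤ k b′)
    ≡⟨ cong (λ t → t₀ +ℤ (t +ℤ sumℤ k b′)) (sumℤ-*ˡ k x _) ⟩
  t₀ +ℤ (x *ℤ c′ +ℤ sumℤ k b′)
    ≡⟨ reorder t₀ (x *ℤ c′) (sumℤ k b′) ⟩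
  (t₀ +ℤ sumℤ k b′) +ℤ x *ℤ c′
    ≡⟨ cong₂ (λ u v → u +ℤ x *ℤ v) (sumℤ-suc k (mvb-term x k)) (mvc-dropLast x k) ⟨
  sumℤ (suc k) (mvb-term x k) +ℤ x *ℤ mvc x (suc k)
    ≡⟨ cong (_+ℤ x *ℤ mvc x (suc k)) (mvb-dropLast x k) ⟩
  mvb x k +ℤ x *ℤ mvc x (suc k)
    ∎
  where
  open ≡-Reasoning
  t₀ = mvb-term x k 0
  b′ = mvb-term x k ∘ suc
  c′ = sumℤ k (mvc-term x (suc k))
  reorder : ∀ a b c → a +ℤ (b +ℤ c) ≡ (a +ℤ c) +ℤ b
  reorder = ℤ-Solver.solve-∀

mv-unique : ∀ x (p q : ℕ → ℤ) → p 0 ≡ 1ℤ → q 0 ≡ 0ℤ →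
  (∀ k → q (suc k) ≡ p k +ℤ q k) → (∀ k → p (suc k) ≡ p k +ℤ x *ℤ q (suc k)) →
  ∀ k → mvb x k ≡ p k × mvc x k ≡ q k
mv-unique x p q p₀ q₀ q-suc p-suc zero    = sym p₀ , sym q₀
mv-unique x p q p₀ q₀ q-suc p-suc (suc k) = mvb≡p , mvc≡q
  where
  ih = mv-unique x p q p₀ q₀ q-suc p-suc k
  mvc≡q : mvc x (suc k) ≡ q (suc k)
  mvc≡q = trans (mvc-suc x k) (trans (cong₂ _+ℤ_ (proj₁ ih) (proj₂ ih)) (sym (q-suc k)))
  mvb≡p : mvb x (suc k) ≡ p (suc k)
  mvb≡p = trans (mvb-suc x k) (trans (cong₂ (λ u v → u +ℤ x *ℤ v) (proj₁ ih) mvc≡q) (sym (p-suc k)))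

sum-odd-weights : ∀ x k →
  sumℚ k (λ i → mvb-term x k i / suc (2 * i)) ≡ (mvc x (suc k) +ℤ mvc x k) / suc (2 * k)
sum-odd-weights x k = begin
  sumℚ k (λ i → mvb-term x k i / suc (2 * i))
    ≡⟨ sumℚ-cong k reweight ⟩
  sumℚ k (λ i → w i / suc (2 * k))
    ≡⟨ sumℚ-/ k (2 * k) w ⟩
  sumℤ k w / suc (2 * k)
    ≡⟨ cong (_/ suc (2 * k)) (sumℤ-cong k split) ⟩
  sumℤ k (λ i → mvc-term x (suc k) i +ℤ mvc-term x k i) / suc (2 * k)
    ≡⟨ cong (_/ suc (2 * k)) (sumℤ-+ k _ _) ⟩
  (sumℤ k (mvc-term x (suc k)) +ℤ mvc x k) / suc (2 * k)
    ≡⟨ cong (λ t → (t +ℤ mvc x k) / suc (2 * k)) (mvc-dropLast x k) ⟨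
  (mvc x (suc k) +ℤ mvc x k) / suc (2 * k)
    ∎
  where
  open ≡-Reasoning
  W : ℕ → ℕ
  W i = suc (k + i) C suc (2 * i) + (k + i) C suc (2 * i)
  w : ℕ → ℤ
  w i = (x ^ℤ i) *ℤ (+ W i)
  *-pos-assoc : ∀ y m n → (y *ℤ (+ m)) *ℤ (+ n) ≡ y *ℤ (+ (m * n))
  *-pos-assoc y m n = trans (ℤ.*-assoc y (+ m) (+ n)) (cong (y *ℤ_) (sym (ℤ.pos-* m n)))
  reweight : ∀ i → mvb-term x k i / suc (2 * i) ≡ w i / suc (2 * k)
  reweight i = *≡*⇒/≡ (mvb-term x k i) (w i) (2 * i) (2 * k) (begin
    mvb-term x k i *ℤ (+ suc (2 * k))                   ≡⟨ *-pos-assoc (x ^ℤ i) _ _ ⟩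
    (x ^ℤ i) *ℤ (+ (((k + i) C (2 * i)) * suc (2 * k))) ≡⟨ cong (λ t → (x ^ℤ i) *ℤ (+ t)) (odd-weight-shift k i) ⟩
    (x ^ℤ i) *ℤ (+ (W i * suc (2 * i)))                 ≡⟨ *-pos-assoc (x ^ℤ i) _ _ ⟨
    w i *ℤ (+ suc (2 * i))                              ∎)
  split : ∀ i → w i ≡ mvc-term x (suc k) i +ℤ mvc-term x k i
  split i = trans (cong ((x ^ℤ i) *ℤ_) (ℤ.pos-+ (suc (k + i) C suc (2 * i)) ((k + i) C suc (2 * i))))
                  (ℤ.*-distribˡ-+ (x ^ℤ i) _ _)

L-suc : ∀ n → L (suc n) ≡ F n + F (suc (suc n))
L-suc zero          = refl
L-suc (suc zero)    = refl
L-suc (suc (suc n)) = trans (cong₂ _+_ (L-suc (suc n)) (L-suc n)) (regroup (F n) (F (suc n)))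
  where
  regroup : ∀ a b → (b + ((b + a) + b)) + (a + (b + a)) ≡ (b + a) + (((b + a) + b) + (b + a))
  regroup = ℕ-Solver.solve-∀

L+L≡5*F : ∀ n → L (suc (suc n)) + L n ≡ 5 * F (suc n)
L+L≡5*F zero          = refl
L+L≡5*F (suc zero)    = refl
L+L≡5*F (suc (suc n)) = begin
  (p + q) + (r + t)                  ≡⟨ interchange p q r t ⟩
  (p + r) + (q + t)                  ≡⟨ cong₂ _+_ (L+L≡5*F (suc n)) (L+L≡5*F n) ⟩
  5 * F (suc (suc n)) + 5 * F (suc n) ≡⟨ *-distribˡ-+ 5 (F (suc (suc n))) (F (suc n)) ⟨
  5 * F (suc (suc (suc n)))          ∎
  where
  open ≡-Reasoning
  p = L (suc (suc (suc n)))
  q = L (suc (suc n))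
  r = L (suc n)
  t = L n
  interchange : ∀ p q r t → (p + q) + (r + t) ≡ (p + r) + (q + t)
  interchange = ℕ-Solver.solve-∀

mv-at-1 : ∀ k → mvb 1ℤ k ≡ + F (suc (2 * k)) × mvc 1ℤ k ≡ + F (2 * k)
mv-at-1 = mv-unique 1ℤ (λ k → + F (suc (2 * k))) (λ k → + F (2 * k)) refl refl q-suc p-suc
  where
  q-suc : ∀ k → + F (2 * suc k) ≡ + F (suc (2 * k)) +ℤ + F (2 * k)
  q-suc k = trans (cong (+_ ∘ F) (two-suc k)) (ℤ.pos-+ (F (suc (2 * k))) (F (2 * k)))
  p-suc : ∀ k → + F (suc (2 * suc k)) ≡ + F (suc (2 * k)) +ℤ 1ℤ *ℤ + F (2 * suc k)
  p-suc k = begin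
    + F (suc (2 * suc k))
      ≡⟨ cong (+_ ∘ F ∘ suc) (two-suc k) ⟩
    + (F (suc (suc n)) + F (suc n))
      ≡⟨ cong +_ (+-comm (F (suc (suc n))) (F (suc n))) ⟩
    + (F (suc n) + F (suc (suc n)))
      ≡⟨ ℤ.pos-+ (F (suc n)) (F (suc (suc n))) ⟩
    + F (suc n) +ℤ + F (suc (suc n))
      ≡⟨ cong (+ F (suc n) +ℤ_) (trans (ℤ.*-identityˡ _) (cong (+_ ∘ F) (two-suc k))) ⟨
    + F (suc n) +ℤ 1ℤ *ℤ + F (2 * suc k)
      ∎
    where
    open ≡-Reasoning
    n = 2 * k

-1^suc : ∀ k → -1ℤ ^ℤ suc k ≡ - (-1ℤ ^ℤ k)
-1^suc k = ℤ.-1*i≡-i (-1ℤ ^ℤ k)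

mv-at-[-5] : ∀ k → mvb -[1+ 4 ] k ≡ (-1ℤ ^ℤ k) *ℤ + L (suc (2 * k))
                 × mvc -[1+ 4 ] k ≡ - ((-1ℤ ^ℤ k) *ℤ + F (2 * k))
mv-at-[-5] = mv-unique -[1+ 4 ] (λ k → (-1ℤ ^ℤ k) *ℤ + L (suc (2 * k)))
                                (λ k → - ((-1ℤ ^ℤ k) *ℤ + F (2 * k)))
                                refl refl q-suc p-suc
  where
  q-suc : ∀ k → - ((-1ℤ ^ℤ suc k) *ℤ + F (2 * suc k))
              ≡ (-1ℤ ^ℤ k) *ℤ + L (suc (2 * k)) +ℤ - ((-1ℤ ^ℤ k) *ℤ + F (2 * k))
  q-suc k = begin
    - ((-1ℤ ^ℤ suc k) *ℤ + F (2 * suc k))  ≡⟨ cong₂ (λ u v → - (u *ℤ + F v)) (-1^suc k) (two-suc k) ⟩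
    - ((- s) *ℤ f₂)                        ≡⟨ ring s f₀ f₂ ⟩
    s *ℤ (f₀ +ℤ f₂) +ℤ - (s *ℤ f₀)         ≡⟨ cong (λ t → s *ℤ t +ℤ - (s *ℤ f₀)) lucas ⟨
    s *ℤ + L (suc n) +ℤ - (s *ℤ f₀)        ∎
    where
    open ≡-Reasoning
    n = 2 * k
    s = -1ℤ ^ℤ k
    f₀ = + F n
    f₂ = + F (suc (suc n))
    lucas : + L (suc n) ≡ f₀ +ℤ f₂
    lucas = trans (cong +_ (L-suc n)) (ℤ.pos-+ (F n) (F (suc (suc n))))
    ring : ∀ s f₀ f₂ → - ((- s) *ℤ f₂) ≡ s *ℤ (f₀ +ℤ f₂) +ℤ - (s *ℤ f₀)
    ring = ℤ-Solver.solve-∀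
  p-suc : ∀ k → (-1ℤ ^ℤ suc k) *ℤ + L (suc (2 * suc k))
              ≡ (-1ℤ ^ℤ k) *ℤ + L (suc (2 * k)) +ℤ -[1+ 4 ] *ℤ - ((-1ℤ ^ℤ suc k) *ℤ + F (2 * suc k))
  p-suc k = begin
    (-1ℤ ^ℤ suc k) *ℤ + L (suc (2 * suc k))
      ≡⟨ cong₂ (λ u v → u *ℤ + L (suc v)) (-1^suc k) (two-suc k) ⟩
    (- s) *ℤ l₃
      ≡⟨ cong ((- s) *ℤ_) (trans (isolate l₃ l₁) (cong (_-ℤ l₁) lucas)) ⟩
    (- s) *ℤ (+ 5 *ℤ f₂ -ℤ l₁)
      ≡⟨ ring s l₁ f₂ (+ 5) ⟩
    s *ℤ l₁ +ℤ - (+ 5) *ℤ - ((- s) *ℤ f₂)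
      ≡⟨ cong₂ (λ u v → s *ℤ l₁ +ℤ -[1+ 4 ] *ℤ - (u *ℤ + F v)) (-1^suc k) (two-suc k) ⟨
    s *ℤ l₁ +ℤ -[1+ 4 ] *ℤ - ((-1ℤ ^ℤ suc k) *ℤ + F (2 * suc k))
      ∎
    where
    open ≡-Reasoning
    n = 2 * k
    s = -1ℤ ^ℤ k
    l₁ = + L (suc n)
    l₃ = + L (suc (suc (suc n)))
    f₂ = + F (suc (suc n))
    lucas : l₃ +ℤ l₁ ≡ + 5 *ℤ f₂
    lucas = trans (sym (ℤ.pos-+ (L (suc (suc (suc n)))) (L (suc n))))
                  (trans (cong +_ (L+L≡5*F (suc n))) (ℤ.pos-* 5 (F (suc (suc n)))))
    isolate : ∀ a b → a ≡ (a +ℤ b) -ℤ b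
    isolate = ℤ-Solver.solve-∀
    ring : ∀ s l₁ f₂ m → (- s) *ℤ (m *ℤ f₂ -ℤ l₁) ≡ s *ℤ l₁ +ℤ (- m) *ℤ - ((- s) *ℤ f₂)
    ring = ℤ-Solver.solve-∀

∑C/[2i+1]≡L/[2k+1] : ∀ k →
  sumℚ k (λ i → (+ ((k + i) C (2 * i))) / suc (2 * i)) ≡ (+ L (suc (2 * k))) / suc (2 * k)
∑C/[2i+1]≡L/[2k+1] k = begin
  sumℚ k (λ i → (+ ((k + i) C (2 * i))) / suc (2 * i))
    ≡⟨ sumℚ-cong k (λ i → cong (_/ suc (2 * i)) (unit-weight i)) ⟨
  sumℚ k (λ i → mvb-term 1ℤ k i / suc (2 * i))
    ≡⟨ sum-odd-weights 1ℤ k ⟩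
  (mvc 1ℤ (suc k) +ℤ mvc 1ℤ k) / suc (2 * k)
    ≡⟨ cong (_/ suc (2 * k)) (cong₂ _+ℤ_ (proj₂ (mv-at-1 (suc k))) (proj₂ (mv-at-1 k))) ⟩
  (+ F (2 * suc k) +ℤ + F (2 * k)) / suc (2 * k)
    ≡⟨ cong (_/ suc (2 * k)) (trans (sym (ℤ.pos-+ (F (2 * suc k)) (F (2 * k)))) (cong +_ lucas)) ⟩
  (+ L (suc (2 * k))) / suc (2 * k)
    ∎
  where
  open ≡-Reasoning
  unit-weight : ∀ i → mvb-term 1ℤ k i ≡ + ((k + i) C (2 * i))
  unit-weight i = trans (cong (_*ℤ (+ ((k + i) C (2 * i)))) (ℤ.^-zeroˡ i))
                        (ℤ.*-identityˡ (+ ((k + i) C (2 * i))))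
  lucas : F (2 * suc k) + F (2 * k) ≡ L (suc (2 * k))
  lucas = trans (cong (λ n → F n + F (2 * k)) (two-suc k))
                (trans (+-comm (F (suc (suc (2 * k)))) (F (2 * k))) (sym (L-suc (2 * k))))

∑[-5]ⁱC/[2i+1]≡±F/[2k+1] : ∀ k →
  sumℚ k (λ i → ((-[1+ 4 ] ^ℤ i) *ℤ (+ ((k + i) C (2 * i)))) / suc (2 * i))
    ≡ ((-1ℤ ^ℤ k) *ℤ (+ F (suc (2 * k)))) / suc (2 * k)
∑[-5]ⁱC/[2i+1]≡±F/[2k+1] k = begin
  sumℚ k (λ i → mvb-term -[1+ 4 ] k i / suc (2 * i))
    ≡⟨ sum-odd-weights -[1+ 4 ] k ⟩
  (mvc -[1+ 4 ] (suc k) +ℤ mvc -[1+ 4 ] k) / suc (2 * k)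
    ≡⟨ cong (_/ suc (2 * k)) (cong₂ _+ℤ_ (proj₂ (mv-at-[-5] (suc k))) (proj₂ (mv-at-[-5] k))) ⟩
  (- ((-1ℤ ^ℤ suc k) *ℤ + F (2 * suc k)) +ℤ - (s *ℤ f₀)) / suc (2 * k)
    ≡⟨ cong (_/ suc (2 * k)) fibonacci ⟩
  (s *ℤ f₁) / suc (2 * k)
    ∎
  where
  open ≡-Reasoning
  n = 2 * k
  s = -1ℤ ^ℤ k
  f₀ = + F n
  f₁ = + F (suc n)
  ring : ∀ s f₀ f₁ → - ((- s) *ℤ (f₁ +ℤ f₀)) +ℤ - (s *ℤ f₀) ≡ s *ℤ f₁
  ring = ℤ-Solver.solve-∀
  fibonacci : - ((-1ℤ ^ℤ suc k) *ℤ + F (2 * suc k)) +ℤ - (s *ℤ f₀) ≡ s *ℤ f₁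
  fibonacci = trans (cong₂ (λ u v → - (u *ℤ + F v) +ℤ - (s *ℤ f₀)) (-1^suc k) (two-suc k))
                    (trans (cong (λ t → - ((- s) *ℤ t) +ℤ - (s *ℤ f₀)) (ℤ.pos-+ (F (suc n)) (F n)))
                           (ring s f₀ f₁))

corollary3p2 : (k : ℕ) →
  (sumℚ k (λ i → (+ ((k + i) C (2 * i))) / suc (2 * i)) ≡ (+ L (2 * k + 1)) / suc (2 * k))
  × (sumℚ k (λ i → ((-[1+ 4 ] ^ℤ i) *ℤ (+ ((k + i) C (2 * i)))) / suc (2 * i))
      ≡ ((-[1+ 0 ] ^ℤ k) *ℤ (+ F (2 * k + 1))) / suc (2 * k))
  × (sumℤ k (λ i → (-[1+ 4 ] ^ℤ i) *ℤ (+ ((k + i) C (2 * i))))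
      ≡ (-[1+ 0 ] ^ℤ k) *ℤ (+ L (2 * k + 1)))
corollary3p2 k rewrite +-comm (2 * k) 1 =
  ∑C/[2i+1]≡L/[2k+1] k , ∑[-5]ⁱC/[2i+1]≡±F/[2k+1] k , proj₁ (mv-at-[-5] k)
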